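{- For every integer $c$, $R(c+1)\subseteq R(c)$. Moreover, for all integers $c_1,c_2$ and multisets $M_1\in R(c_1)$, $M_2\in R(c_2)$, one has $M_1+M_2\in R(c_1+c_2)$.
   Context: All multisets are finite multisets of integers; $\mathrm{mult}(i,M)$ is the multiplicity of $i$ in $M$. $M_1+M_2$ is the multiset $\{i_1+i_2: i_1\in M_1,i_2\in M_2\}$ counted with multiplicity, i.e. $\mathrm{mult}(i,M_1+M_2)=\sum_{k}\mathrm{mult}(i-k,M_1)\mathrm{mult}(k,M_2)$; $\cup$ denotes multiset union. For integers $a\le b$ with $a\equiv b\pmod 2$, $[a,b]=\{a,a+2,\dots,b\}$. For an integer $c$, $R(c)$ is the set of multisets of the form $\bigcup_{i=1}^{k_1}\{m_i\}\cup\bigcup_{i=1}^{k_2}[c-n_i,c+n_i]$ for some integers $k_1,k_2\ge 0$, $m_i\ge c$, $n_i\ge 1$. -}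

module Defs where

open import Data.Nat as ℕ using (ℕ; zero; suc)
open import Data.Integer using (ℤ; +_; _+_; _-_; _≤_)
open import Data.List using (List; []; _∷_; _++_; map; concat; concatMap; upTo)
open import Data.List.Relation.Unary.All using (All)
open import Data.List.Relation.Binary.Permutation.Propositional using (_↭_)
open import Data.Product using (Σ; ∃; _×_; _,_)

-- Finite multisets of integers are represented by lists of integers;
-- two lists represent the same multiset iff they are permutations
-- of each other (_↭_).
Multiset : Set
Multiset = List ℤ

_∪ₘ_ : Multiset → Multiset → Multiset
M₁ ∪ₘ M₂ = M₁ ++ M₂

_⊕_ : Multiset → Multiset → Multiset
M₁ ⊕ M₂ = concatMap (λ i₁ → map (λ i₂ → i₁ + i₂) M₂) M₁

-- The interval [c - n, c + n] = {c - n, c - n + 2, ..., c + n}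
-- (n + 1 elements).
interval : ℤ → ℕ → Multiset
interval c n = map (λ k → (c - + n) + + (2 ℕ.* k)) (upTo (suc n))

InR : ℤ → Multiset → Set
InR c M =
  Σ (List ℤ) λ ms → Σ (List ℕ) λ ns →
    All (λ m → c ≤ m) ms × All (λ n → 1 ℕ.≤ n) ns ×
    (M ↭ (ms ∪ₘ concat (map (interval c) ns)))

-- Both parts rest on one observation: an arithmetic progression of step 2
-- whose centre is at least c lies in R(c).  Indeed, if the centre exceeds c,
-- dropping the largest term (which is ≥ c) lowers the centre by one, and a
-- progression centred exactly at c is an interval [c - n, c + n].
--
-- Every member of R(c) is a union of such progressions (singletons {m} with
-- m ≥ c, and intervals), so R(c + 1) ⊆ R(c) is immediate.  For sums, the
-- sumset of two progressions with centres γ₁ ≥ c₁, γ₂ ≥ c₂ is a grid; its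
-- first row together with its last column is a progression centred at
-- γ₁ + γ₂, and what remains is again the sumset of two progressions with the
-- same total centre.  Peeling off these hooks shows the sumset lies in
-- R(c₁ + c₂), and sumsets distribute over unions.
module Submission where

open import Defs
open import Data.Integer using (ℤ; _+_; +_)
open import Data.Product using (_×_)

open import Algebra.Bundles using (CommutativeMonoid)
open import Data.Integer using (-_; _-_; _≤_; +≤+; pred; _≟_)
open import Data.Integer.Properties
  using (≤-trans; ≤-reflexive; ≤∧≢⇒<; i<j⇒i≤pred[j]; i≤i+j;
         +-monoʳ-≤; +-mono-≤; +-identityʳ; module ≤-Reasoning)
open import Data.Integer.Tactic.RingSolver using (solve-∀)
open import Data.List using (List; []; _∷_; _++_; _∷ʳ_; [_]; map; concat; upTo)
open import Data.List.Properties
  using (++-assoc; map-++; concat-++; concat-map-[_]; concatMap-++; upTo-∷ʳ)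
open import Data.List.Relation.Unary.All as All using (All; []; _∷_)
open import Data.List.Relation.Unary.All.Properties as All using (gmap⁺)
open import Data.List.Relation.Binary.Permutation.Propositional as Perm
  using (_↭_; ↭-refl; ↭-sym; ↭-trans; module PermutationReasoning)
open import Data.List.Relation.Binary.Permutation.Propositional.Properties as ↭
  using (++⁺ˡ; ++⁺; shifts; ++-commutativeMonoid)
open import Data.Nat as ℕ using (ℕ; zero; suc)
open import Data.Nat.Properties as ℕ using ()
open import Data.Product using (∃; _,_)
open import Relation.Binary.PropositionalEquality
  using (_≡_; refl; sym; trans; cong; cong₂; subst; module ≡-Reasoning)
open import Relation.Nullary using (yes; no)
open import Function using (_∘_)

open import Algebra.Properties.CommutativeSemigroup
  (CommutativeMonoid.commutativeSemigroup (++-commutativeMonoid {A = ℤ}))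
  using (interchange)

progression : ℤ → ℕ → List ℤ
progression a zero    = []
progression a (suc n) = a ∷ progression (a + + 2) n

+-2*-suc : ∀ a n → a + + (2 ℕ.* suc n) ≡ (a + + 2) + + (2 ℕ.* n)
+-2*-suc a n = begin
  a + + (2 ℕ.* suc n)       ≡⟨ cong (λ k → a + + k) (ℕ.*-suc 2 n) ⟩
  a + (+ 2 + + (2 ℕ.* n))   ≡⟨ assoc a (+ 2) (+ (2 ℕ.* n)) ⟩
  (a + + 2) + + (2 ℕ.* n)   ∎
  where
  open ≡-Reasoning
  assoc : ∀ a b c → a + (b + c) ≡ (a + b) + c
  assoc = solve-∀

progression-∷ʳ : ∀ a n → progression a n ∷ʳ (a + + (2 ℕ.* n)) ≡ progression a (suc n)
progression-∷ʳ a zero    = cong [_] (+-identityʳ a)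
progression-∷ʳ a (suc n) = cong (a ∷_) (trans
  (cong (progression (a + + 2) n ∷ʳ_) (+-2*-suc a n)) (progression-∷ʳ (a + + 2) n))

progression-++ : ∀ a m n →
  progression a m ++ progression (a + + (2 ℕ.* m)) n ≡ progression a (m ℕ.+ n)
progression-++ a zero    n = cong (λ b → progression b n) (+-identityʳ a)
progression-++ a (suc m) n = cong (a ∷_) (trans
  (cong (λ b → progression (a + + 2) m ++ progression b n) (+-2*-suc a m))
  (progression-++ (a + + 2) m n))

map-+-progression : ∀ x a n → map (_+_ x) (progression a n) ≡ progression (x + a) n
map-+-progression x a zero    = refl
map-+-progression x a (suc n) = cong (x + a ∷_) (trans
  (map-+-progression x (a + + 2) n) (cong (λ b → progression b n) (assoc x a (+ 2))))
  where
  assoc : ∀ a b c → a + (b + c) ≡ (a + b) + c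
  assoc = solve-∀

map-upTo-progression : ∀ a n → map (λ k → a + + (2 ℕ.* k)) (upTo n) ≡ progression a n
map-upTo-progression a zero    = refl
map-upTo-progression a (suc n) = begin
  map f (upTo (suc n))         ≡⟨ cong (map f) (upTo-∷ʳ n) ⟨
  map f (upTo n ∷ʳ n)          ≡⟨ map-++ f (upTo n) [ n ] ⟩
  map f (upTo n) ∷ʳ f n        ≡⟨ cong (_∷ʳ f n) (map-upTo-progression a n) ⟩
  progression a n ∷ʳ f n       ≡⟨ progression-∷ʳ a n ⟩
  progression a (suc n)        ∎
  where
  open ≡-Reasoning
  f : ℕ → ℤ
  f k = a + + (2 ℕ.* k)

interval≡progression : ∀ c n → interval c n ≡ progression (c - + n) (suc n)
interval≡progression c n = map-upTo-progression (c - + n) (suc n)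

⊕-[]ʳ : ∀ A → A ⊕ [] ≡ []
⊕-[]ʳ []      = refl
⊕-[]ʳ (a ∷ A) = ⊕-[]ʳ A

⊕-++ˡ : ∀ A A′ B → (A ++ A′) ⊕ B ≡ (A ⊕ B) ++ (A′ ⊕ B)
⊕-++ˡ A A′ B = concatMap-++ _ A A′

⊕-++ʳ : ∀ A B B′ → A ⊕ (B ++ B′) ↭ (A ⊕ B) ++ (A ⊕ B′)
⊕-++ʳ []      B B′ = ↭-refl
⊕-++ʳ (a ∷ A) B B′ = begin
  map (_+_ a) (B ++ B′) ++ A ⊕ (B ++ B′) ≡⟨ cong (_++ A ⊕ (B ++ B′)) (map-++ (_+_ a) B B′) ⟩
  (a+B ++ a+B′) ++ A ⊕ (B ++ B′)         ↭⟨ ++⁺ˡ (a+B ++ a+B′) (⊕-++ʳ A B B′) ⟩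
  (a+B ++ a+B′) ++ (A ⊕ B ++ A ⊕ B′)     ↭⟨ interchange a+B a+B′ (A ⊕ B) (A ⊕ B′) ⟩
  (a+B ++ A ⊕ B) ++ (a+B′ ++ A ⊕ B′)     ∎
  where
  open PermutationReasoning
  a+B a+B′ : List ℤ
  a+B  = map (_+_ a) B
  a+B′ = map (_+_ a) B′

progression-⊕-[_] : ∀ y a n → progression a n ⊕ [ y ] ≡ progression (a + y) n
progression-⊕-[ y ] a zero    = refl
progression-⊕-[ y ] a (suc n) = cong (a + y ∷_) (trans
  (progression-⊕-[ y ] (a + + 2) n) (cong (λ b → progression b n) (swap-right a (+ 2) y)))
  where
  swap-right : ∀ a b c → (a + b) + c ≡ (a + c) + b
  swap-right = solve-∀

⊕⁺ˡ : ∀ {A A′} B → A ↭ A′ → A ⊕ B ↭ A′ ⊕ B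
⊕⁺ˡ B Perm.refl         = ↭-refl
⊕⁺ˡ B (Perm.prep x p)   = ++⁺ˡ (map (_+_ x) B) (⊕⁺ˡ B p)
⊕⁺ˡ B (Perm.swap x y p) = ↭-trans (shifts (map (_+_ x) B) (map (_+_ y) B))
  (++⁺ˡ (map (_+_ y) B) (++⁺ˡ (map (_+_ x) B) (⊕⁺ˡ B p)))
⊕⁺ˡ B (Perm.trans p q)  = ↭-trans (⊕⁺ˡ B p) (⊕⁺ˡ B q)

⊕⁺ʳ : ∀ A {B B′} → B ↭ B′ → A ⊕ B ↭ A ⊕ B′
⊕⁺ʳ []      p = ↭-refl
⊕⁺ʳ (a ∷ A) p = ++⁺ (↭.map⁺ (_+_ a) p) (⊕⁺ʳ A p)

⊕⁺ : ∀ {A A′ B B′} → A ↭ A′ → B ↭ B′ → A ⊕ B ↭ A′ ⊕ B′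
⊕⁺ {A′ = A′} {B} p q = ↭-trans (⊕⁺ˡ B p) (⊕⁺ʳ A′ q)

InR-[] : ∀ c → InR c []
InR-[] c = [] , [] , [] , [] , ↭-refl

InR-resp-↭ : ∀ {c M N} → M ↭ N → InR c M → InR c N
InR-resp-↭ p (ms , ns , ms≥c , ns≥1 , q) = ms , ns , ms≥c , ns≥1 , ↭-trans (↭-sym p) q

InR-++ : ∀ {c M N} → InR c M → InR c N → InR c (M ++ N)
InR-++ {c} {M} {N} (ms₁ , ns₁ , ms₁≥c , ns₁≥1 , p₁) (ms₂ , ns₂ , ms₂≥c , ns₂≥1 , p₂) =
  ms₁ ++ ms₂ , ns₁ ++ ns₂ , All.++⁺ ms₁≥c ms₂≥c , All.++⁺ ns₁≥1 ns₂≥1 , (begin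
    M ++ N                                  ↭⟨ ++⁺ p₁ p₂ ⟩
    (ms₁ ++ I ns₁) ++ (ms₂ ++ I ns₂)        ↭⟨ interchange ms₁ (I ns₁) ms₂ (I ns₂) ⟩
    (ms₁ ++ ms₂) ++ (I ns₁ ++ I ns₂)        ≡⟨ cong ((ms₁ ++ ms₂) ++_) (concat-++ (map (interval c) ns₁) _) ⟩
    (ms₁ ++ ms₂) ++ concat (map (interval c) ns₁ ++ map (interval c) ns₂)
                                            ≡⟨ cong (λ xs → (ms₁ ++ ms₂) ++ concat xs) (map-++ (interval c) ns₁ ns₂) ⟨
    (ms₁ ++ ms₂) ++ I (ns₁ ++ ns₂)          ∎)
  where
  open PermutationReasoning
  I : List ℕ → List ℤ
  I ns = concat (map (interval c) ns)

InR-concat : ∀ {c Ms} → All (InR c) Ms → InR c (concat Ms)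
InR-concat {c} []       = InR-[] c
InR-concat     (r ∷ rs) = InR-++ r (InR-concat rs)

InR-[_] : ∀ {c m} → c ≤ m → InR c [ m ]
InR-[ c≤m ] = _ ∷ [] , [] , c≤m ∷ [] , [] , ↭-refl

InR-interval : ∀ c n → InR c (interval c n)
InR-interval c zero    =
  interval c 0 , [] , ≤-reflexive (c≡c-0+0 c) ∷ [] , [] , ↭-sym (↭.++-identityʳ _)
  where
  c≡c-0+0 : ∀ c → c ≡ (c - + 0) + + 0
  c≡c-0+0 = solve-∀
InR-interval c (suc n) = [] , suc n ∷ [] , [] , ℕ.s≤s ℕ.z≤n ∷ [] , ↭-sym (↭.++-identityʳ _)

progression∈R : ∀ {c} a l → c ≤ a + + l → InR c (progression a (suc l))
progression∈R a zero c≤a+0 = InR-[ ≤-trans c≤a+0 (≤-reflexive (+-identityʳ a)) ]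
progression∈R {c} a (suc l) c≤centre with c ≟ a + + suc l
... | yes c≡centre = subst (λ b → InR c (progression b (suc (suc l)))) c-l≡a
  (subst (InR c) (interval≡progression c (suc l)) (InR-interval c (suc l)))
  where
  cancel : ∀ a n → (a + n) - n ≡ a
  cancel = solve-∀
  c-l≡a : c - + suc l ≡ a
  c-l≡a = trans (cong (_- + suc l) c≡centre) (cancel a (+ suc l))
... | no c≢centre = subst (InR c) (progression-∷ʳ a (suc l))
  (InR-++ (progression∈R a l c≤a+l) InR-[ c≤last ])
  where
  open ≤-Reasoning
  pred-centre : ∀ a l → - + 1 + (a + (+ 1 + l)) ≡ a + l
  pred-centre = solve-∀
  c≤a+l : c ≤ a + + l
  c≤a+l = begin
    c                    ≤⟨ i<j⇒i≤pred[j] (≤∧≢⇒< c≤centre c≢centre) ⟩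
    pred (a + + suc l)   ≡⟨ pred-centre a (+ l) ⟩
    a + + l              ∎
  c≤last : c ≤ a + + (2 ℕ.* suc l)
  c≤last = begin
    c                    ≤⟨ c≤centre ⟩
    a + + suc l          ≤⟨ +-monoʳ-≤ a (+≤+ (ℕ.m≤m+n (suc l) _)) ⟩
    a + + (2 ℕ.* suc l)  ∎

progression-⊕-hook : ∀ a b m k →
  progression a (suc m) ⊕ progression b (suc k) ↭
  progression (a + b) (suc (k ℕ.+ m)) ++ (progression (a + + 2) m ⊕ progression b k)
progression-⊕-hook a b m k = begin
  map (_+_ a) (progression b (suc k)) ++ P ⊕ progression b (suc k)
    ≡⟨ cong₂ (λ X Y → X ++ P ⊕ Y) (map-+-progression a b (suc k)) (sym (progression-∷ʳ b k)) ⟩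
  row ++ P ⊕ (progression b k ++ [ y ])    ↭⟨ ++⁺ˡ row (⊕-++ʳ P (progression b k) [ y ]) ⟩
  row ++ (rest ++ P ⊕ [ y ])               ≡⟨ cong (λ Z → row ++ (rest ++ Z)) (progression-⊕-[ y ] (a + + 2) m) ⟩
  row ++ (rest ++ column)                  ↭⟨ ++⁺ˡ row (↭.++-comm rest column) ⟩
  row ++ (column ++ rest)                  ≡⟨ ++-assoc row column rest ⟨
  (row ++ column) ++ rest                  ≡⟨ cong (λ z → (row ++ progression z m) ++ rest) corner ⟩
  (row ++ progression ((a + b) + + (2 ℕ.* suc k)) m) ++ rest
                                           ≡⟨ cong (_++ rest) (progression-++ (a + b) (suc k) m) ⟩
  progression (a + b) (suc (k ℕ.+ m)) ++ rest ∎
  where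
  open PermutationReasoning
  y : ℤ
  y = b + + (2 ℕ.* k)
  P row column rest : List ℤ
  P      = progression (a + + 2) m
  row    = progression (a + b) (suc k)
  column = progression (a + + 2 + y) m
  rest   = P ⊕ progression b k
  shuffle : ∀ a b t → (a + + 2) + (b + t) ≡ ((a + b) + + 2) + t
  shuffle = solve-∀
  corner : a + + 2 + y ≡ (a + b) + + (2 ℕ.* suc k)
  corner = trans (shuffle a b (+ (2 ℕ.* k))) (sym (+-2*-suc (a + b) k))

progression-⊕-progression∈R : ∀ {c} a b m k → c ≤ (a + + m) + (b + + k) →
  InR c (progression a (suc m) ⊕ progression b (suc k))
progression-⊕-progression∈R {c} a b m k c≤centres =
  InR-resp-↭ (↭-sym (progression-⊕-hook a b m k))
    (InR-++ (progression∈R (a + b) (k ℕ.+ m) c≤hook-centre) (rest m k c≤centres))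
  where
  hook-centre : ∀ a b m k → (a + m) + (b + k) ≡ (a + b) + (k + m)
  hook-centre = solve-∀
  c≤hook-centre : c ≤ (a + b) + + (k ℕ.+ m)
  c≤hook-centre = ≤-trans c≤centres (≤-reflexive (hook-centre a b (+ m) (+ k)))
  rest-centre : ∀ a b m k → (a + (+ 1 + m)) + (b + (+ 1 + k)) ≡ ((a + + 2) + m) + (b + k)
  rest-centre = solve-∀
  rest : ∀ m k → c ≤ (a + + m) + (b + + k) → InR c (progression (a + + 2) m ⊕ progression b k)
  rest zero    k       _  = InR-[] c
  rest (suc m) zero    _  = subst (InR c) (sym (⊕-[]ʳ (progression (a + + 2) (suc m)))) (InR-[] c)
  rest (suc m) (suc k) c≤ = progression-⊕-progression∈R (a + + 2) b m k
    (≤-trans c≤ (≤-reflexive (rest-centre a b (+ m) (+ k))))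

-- The progression starting at a with l + 1 terms has centre a + l.
CentredAbove : ℤ → List ℤ → Set
CentredAbove c X = ∃ λ a → ∃ λ l → X ≡ progression a (suc l) × c ≤ a + + l

centredAbove⇒InR : ∀ {c X} → CentredAbove c X → InR c X
centredAbove⇒InR (a , l , refl , c≤centre) = progression∈R a l c≤centre

centredAbove-suc : ∀ {c X} → CentredAbove (c + + 1) X → CentredAbove c X
centredAbove-suc {c} (a , l , X≡ , c+1≤centre) = a , l , X≡ , ≤-trans (i≤i+j c (+ 1)) c+1≤centre

centredAbove-⊕ : ∀ {c₁ c₂ X Y} → CentredAbove c₁ X → CentredAbove c₂ Y → InR (c₁ + c₂) (X ⊕ Y)
centredAbove-⊕ (a , l , refl , c₁≤) (b , k , refl , c₂≤) =
  progression-⊕-progression∈R a b l k (+-mono-≤ c₁≤ c₂≤)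

InR⇒concat-centredAbove : ∀ {c M} → InR c M →
  ∃ λ Xs → All (CentredAbove c) Xs × M ↭ concat Xs
InR⇒concat-centredAbove {c} {M} (ms , ns , ms≥c , _ , p) =
  map [_] ms ++ map (interval c) ns ,
  All.++⁺ (gmap⁺ singleton ms≥c) (All.map⁺ (All.universal interval-centred ns)) ,
  (begin
    M                                          ↭⟨ p ⟩
    ms ++ I                                    ≡⟨ cong (_++ I) (concat-map-[ ms ]) ⟨
    concat (map [_] ms) ++ I                   ≡⟨ concat-++ (map [_] ms) (map (interval c) ns) ⟩
    concat (map [_] ms ++ map (interval c) ns) ∎)
  where
  open PermutationReasoning
  I : List ℤ
  I = concat (map (interval c) ns)
  singleton : ∀ {m} → c ≤ m → CentredAbove c [ m ]
  singleton {m} c≤m = m , 0 , refl , ≤-trans c≤m (≤-reflexive (sym (+-identityʳ m)))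
  centred : ∀ c n → c ≡ (c - n) + n
  centred = solve-∀
  interval-centred : ∀ n → CentredAbove c (interval c n)
  interval-centred n = c - + n , n , interval≡progression c n , ≤-reflexive (centred c (+ n))

concat-⊕-concat : ∀ {c} {P Q : List ℤ → Set} →
  (∀ {X Y} → P X → Q Y → InR c (X ⊕ Y)) →
  ∀ {Xs Ys} → All P Xs → All Q Ys → InR c (concat Xs ⊕ concat Ys)
concat-⊕-concat {c} P⊕Q∈R []                  _   = InR-[] c
concat-⊕-concat {c} P⊕Q∈R {X ∷ Xs} {Ys} (pX ∷ pXs) qYs =
  subst (InR c) (sym (⊕-++ˡ X (concat Xs) (concat Ys)))
    (InR-++ (row qYs) (concat-⊕-concat P⊕Q∈R pXs qYs))
  where
  row : ∀ {Ys} → All _ Ys → InR c (X ⊕ concat Ys)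
  row {[]}     []         = subst (InR c) (sym (⊕-[]ʳ X)) (InR-[] c)
  row {Y ∷ Ys} (qY ∷ qYs) =
    InR-resp-↭ (↭-sym (⊕-++ʳ X Y (concat Ys))) (InR-++ (P⊕Q∈R pX qY) (row qYs))

lemma5 : ((c : ℤ) → (M : Multiset) → InR (c + + 1) M → InR c M)
    × ((c₁ c₂ : ℤ) → (M₁ M₂ : Multiset) → InR c₁ M₁ → InR c₂ M₂ → InR (c₁ + c₂) (M₁ ⊕ M₂))
lemma5 = R-antitone , R-⊕
  where
  R-antitone : (c : ℤ) → (M : Multiset) → InR (c + + 1) M → InR c M
  R-antitone c M M∈R with Xs , Xs-centred , M↭ ← InR⇒concat-centredAbove M∈R =
    InR-resp-↭ (↭-sym M↭) (InR-concat (All.map (centredAbove⇒InR ∘ centredAbove-suc) Xs-centred))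
  R-⊕ : (c₁ c₂ : ℤ) → (M₁ M₂ : Multiset) → InR c₁ M₁ → InR c₂ M₂ → InR (c₁ + c₂) (M₁ ⊕ M₂)
  R-⊕ c₁ c₂ M₁ M₂ M₁∈R M₂∈R
    with Xs , Xs-centred , M₁↭ ← InR⇒concat-centredAbove M₁∈R
       | Ys , Ys-centred , M₂↭ ← InR⇒concat-centredAbove M₂∈R =
    InR-resp-↭ (↭-sym (⊕⁺ M₁↭ M₂↭)) (concat-⊕-concat centredAbove-⊕ Xs-centred Ys-centred)
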